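{- Let $(L;\wedge,\vee,^{\Delta},^{\nabla},0,1)$ be a weakly dicomplemented lattice, $E$ a filter of $\overline{S}(L)$ and $F$ a filter of $L$. (1) $E$ is a primary filter of $\overline{S}(L)$ if and only if $E$ is a prime filter of $\overline{S}(L)$. (2) If $E$ is a primary filter of $\overline{S}(L)$, then $E$ is a maximal filter of $\overline{S}(L)$, i.e. there is no filter $H$ of $\overline{S}(L)$ with $E\subsetneq H\subsetneq\overline{S}(L)$. (3) If $F$ is a maximal filter of $L$ (a proper filter not strictly contained in any proper filter of $L$), then $F$ is a primary filter of $L$. The converse does not hold: there exist a weakly dicomplemented lattice and a primary filter of it that is not a maximal filter.
   Context: A weakly dicomplemented lattice (WDL) is an algebra $(L;\wedge,\vee,^{\Delta},^{\nabla},0,1)$ such that $(L;\wedge,\vee,0,1)$ is a bounded lattice and, for all $x,y\in L$: $x^{\Delta\Delta}\le x$; $x\le y\Rightarrow y^{\Delta}\le x^{\Delta}$; $(x\wedge y)\vee(x\wedge y^{\Delta})=x$; $x^{\nabla\nabla}\ge x$; $x\le y\Rightarrow y^{\nabla}\le x^{\nabla}$; $(x\vee y)\wedge(x\vee y^{\nabla})=x$. A filter of $L$ is a nonempty upward closed subset closed under $\wedge$; it is primary if for every $x\in L$, $x\in F$ or $x^{\Delta}\in F$. $\overline{S}(L)=\{x\in L\mid x^{\Delta\Delta}=x\}$, $x\,\overline{\sqcap}\,y=(x^{\Delta}\vee y^{\Delta})^{\Delta}$; $(\overline{S}(L);\overline{\sqcap},\vee,^{\Delta},0,1)$ is an ortholattice.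 A filter of $\overline{S}(L)$ is a nonempty subset of $\overline{S}(L)$ upward closed within $\overline{S}(L)$ and closed under $\overline{\sqcap}$; it is primary if for every $x\in\overline{S}(L)$, $x\in E$ or $x^{\Delta}\in E$, and prime if for $x,y\in\overline{S}(L)$, $x\vee y\in E$ implies $x\in E$ or $y\in E$. -}

module Defs where

open import Level using (Level; _⊔_; 0ℓ) renaming (suc to lsuc)
open import Algebra.Core using (Op₁; Op₂)
open import Algebra.Lattice.Structures using (IsLattice)
open import Relation.Binary.PropositionalEquality using (_≡_)
open import Relation.Unary using (Pred; _⊆_; _∈_; _∉_)
open import Data.Product using (Σ; ∃; _×_)
open import Data.Sum using (_⊎_)
open import Relation.Nullary using (¬_)

-- A weakly dicomplemented lattice, equality being propositional equality
-- on the carrier.  The order is the lattice order  x ≤ y  :⇔  x ∧ y ≡ x.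
record WDL (c : Level) : Set (lsuc c) where
  infixr 7 _∧_
  infixr 6 _∨_
  infix 8 _ᐞ _ᐯ
  field
    Carrier   : Set c
    _∧_ _∨_   : Op₂ Carrier
    _ᐞ        : Op₁ Carrier
    _ᐯ        : Op₁ Carrier
    𝟘 𝟙       : Carrier
    isLattice : IsLattice _≡_ _∨_ _∧_
    𝟘-least    : ∀ x → 𝟘 ∧ x ≡ 𝟘
    𝟙-greatest : ∀ x → x ∧ 𝟙 ≡ x
    ΔΔ-deflationary : ∀ x → (x ᐞ) ᐞ ∧ x ≡ (x ᐞ) ᐞ
    Δ-antitone : ∀ x y → x ∧ y ≡ x → y ᐞ ∧ x ᐞ ≡ y ᐞ
    Δ-split : ∀ x y → (x ∧ y) ∨ (x ∧ y ᐞ) ≡ x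
    ∇∇-inflationary : ∀ x → x ∧ (x ᐯ) ᐯ ≡ x
    ∇-antitone : ∀ x y → x ∧ y ≡ x → y ᐯ ∧ x ᐯ ≡ y ᐯ
    ∇-split : ∀ x y → (x ∨ y) ∧ (x ∨ y ᐯ) ≡ x

module WDLTheory {c : Level} (L : WDL c) where
  open WDL L public

  infix 4 _≤_
  _≤_ : Carrier → Carrier → Set c
  x ≤ y = x ∧ y ≡ x

  S̄ : Pred Carrier c
  S̄ x = (x ᐞ) ᐞ ≡ x

  -- meet of S̄(L):  x ⊓̄ y = (x^Δ ∨ y^Δ)^Δ
  _⊓̄_ : Op₂ Carrier
  x ⊓̄ y = (x ᐞ ∨ y ᐞ) ᐞ

  _⊊_ : ∀ {ℓ₁ ℓ₂} → Pred Carrier ℓ₁ → Pred Carrier ℓ₂ → Set (c ⊔ ℓ₁ ⊔ ℓ₂)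
  A ⊊ B = A ⊆ B × ∃ λ x → x ∈ B × x ∉ A

  record IsFilter {ℓ} (F : Pred Carrier ℓ) : Set (c ⊔ ℓ) where
    field
      nonempty : ∃ λ x → x ∈ F
      up-closed : ∀ {x y} → x ∈ F → x ≤ y → y ∈ F
      ∧-closed : ∀ {x y} → x ∈ F → y ∈ F → x ∧ y ∈ F

  IsPrimaryFilter : ∀ {ℓ} → Pred Carrier ℓ → Set (c ⊔ ℓ)
  IsPrimaryFilter F = IsFilter F × (∀ x → x ∈ F ⊎ x ᐞ ∈ F)

  IsProper : ∀ {ℓ} → Pred Carrier ℓ → Set (c ⊔ ℓ)
  IsProper F = ∃ λ x → x ∉ F

  -- maximal filter: a proper filter not strictly contained in any proper
  -- filter of L (filters compared at the same universe level)
  IsMaximalFilter : ∀ {ℓ} → Pred Carrier ℓ → Set (c ⊔ lsuc ℓ)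
  IsMaximalFilter {ℓ} F =
    IsFilter F × IsProper F ×
    ¬ (Σ (Pred Carrier ℓ) λ G → IsFilter G × IsProper G × F ⊊ G)

  record IsS̄Filter {ℓ} (E : Pred Carrier ℓ) : Set (c ⊔ ℓ) where
    field
      ⊆S̄ : E ⊆ S̄
      nonempty : ∃ λ x → x ∈ E
      up-closed : ∀ {x y} → x ∈ E → y ∈ S̄ → x ≤ y → y ∈ E
      ⊓̄-closed : ∀ {x y} → x ∈ E → y ∈ E → x ⊓̄ y ∈ E

  IsPrimaryS̄Filter : ∀ {ℓ} → Pred Carrier ℓ → Set (c ⊔ ℓ)
  IsPrimaryS̄Filter E = IsS̄Filter E × (∀ x → x ∈ S̄ → x ∈ E ⊎ x ᐞ ∈ E)

  IsPrimeS̄Filter : ∀ {ℓ} → Pred Carrier ℓ → Set (c ⊔ ℓ)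
  IsPrimeS̄Filter E =
    IsS̄Filter E × (∀ x y → x ∈ S̄ → y ∈ S̄ → x ∨ y ∈ E → x ∈ E ⊎ y ∈ E)

  IsMaximalS̄Filter : ∀ {ℓ} → Pred Carrier ℓ → Set (c ⊔ lsuc ℓ)
  IsMaximalS̄Filter {ℓ} E =
    IsS̄Filter E × ¬ (Σ (Pred Carrier ℓ) λ H → IsS̄Filter H × E ⊊ H × H ⊊ S̄)

-- In the ortholattice S̄(L) an element meets its complement in 0, since
-- x ⊓̄ x^Δ = (x^Δ ∨ x^ΔΔ)^Δ = 1^Δ = 0, so a filter of S̄(L) containing both
-- x and x^Δ is all of S̄(L).  This gives primary ⇒ prime (if x, y ∉ E then
-- (x ∨ y)^Δ = x^Δ ⊓̄ y^Δ ∈ E) and primary ⇒ maximal, while prime ⇒ primary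
-- is x ∨ x^Δ = 1.  If F is a maximal filter of L and x ∉ F, then the filter
-- generated by F and x is improper, so f ∧ x = 0 for some f ∈ F, and
-- f = (f ∧ x) ∨ (f ∧ x^Δ) ≤ x^Δ puts x^Δ in F.  In the chain 0 < a < 1 with
-- x^Δ = 1 for x ≠ 1, the filter {1} is primary but lies in the proper
-- filter {a, 1}.
{-# OPTIONS --safe #-}
module Submission where

open import Defs
open import Level using (Level; _⊔_; 0ℓ; Lift; lift; lower)
open import Relation.Unary using (Pred; _∈_; _∉_; _⊆_; _≐_)
open import Data.Product using (Σ; _×_; _,_; proj₁; proj₂)
open import Data.Sum using (_⊎_; inj₁; inj₂; [_,_]′)
open import Data.Empty using (⊥)
open import Data.Unit using (⊤; tt)
open import Function using (_∘_)
open import Relation.Nullary using (¬_; yes; no)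
open import Relation.Nullary.Decidable using (True; toWitness; fromWitness)
open import Function.Bundles using (_⇔_; mk⇔)
open import Axiom.ExcludedMiddle using (ExcludedMiddle)
open import Axiom.DoubleNegationElimination using (em⇒dne)
open import Relation.Binary.PropositionalEquality
open import Algebra.Lattice.Structures using (IsLattice)
open import Algebra.Lattice.Bundles using (Lattice)
import Algebra.Lattice.Properties.Lattice as LatticeProperties

-- Excluded middle at level p turns every P : Set p into the proposition
-- "em decided P", which lives in Set 0ℓ and can therefore be lifted to any
-- level.
module Resize {p} (em : ExcludedMiddle p) where

  Resized : ∀ {ℓ} → Set p → Set ℓ
  Resized {ℓ} P = Lift ℓ (True (em {P}))

  resize : ∀ {ℓ} {P : Set p} → P → Resized {ℓ} P
  resize x = lift (fromWitness x)

  unresize : ∀ {ℓ} {P : Set p} → Resized {ℓ} P → P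
  unresize r = toWitness (lower r)

module WDLProperties {c : Level} (L : WDL c) where
  open WDLTheory L
  open IsLattice isLattice using (∧-comm; ∧-assoc; ∨-comm; ∨-absorbs-∧)

  lattice : Lattice c c
  lattice = record { isLattice = isLattice }

  open LatticeProperties lattice using (∧-idem)
  open ≡-Reasoning

  ≤-trans : ∀ {x y z} → x ≤ y → y ≤ z → x ≤ z
  ≤-trans {x} {y} {z} x≤y y≤z = begin
    x ∧ z        ≡⟨ cong (_∧ z) x≤y ⟨
    (x ∧ y) ∧ z  ≡⟨ ∧-assoc x y z ⟩
    x ∧ (y ∧ z)  ≡⟨ cong (x ∧_) y≤z ⟩
    x ∧ y        ≡⟨ x≤y ⟩
    x            ∎

  x∧y≤y : ∀ x y → x ∧ y ≤ y
  x∧y≤y x y = trans (∧-assoc x y y) (cong (x ∧_) (∧-idem y))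

  x∧y≤x : ∀ x y → x ∧ y ≤ x
  x∧y≤x x y = subst (_≤ x) (∧-comm y x) (x∧y≤y y x)

  ∧-greatest : ∀ {x y z} → x ≤ y → x ≤ z → x ≤ y ∧ z
  ∧-greatest {x} {y} {z} x≤y x≤z =
    trans (sym (∧-assoc x y z)) (trans (cong (_∧ z) x≤y) x≤z)

  ∧-monoˡ-≤ : ∀ {x y} z → x ≤ y → x ∧ z ≤ y ∧ z
  ∧-monoˡ-≤ {x} z x≤y = ∧-greatest (≤-trans (x∧y≤x x z) x≤y) (x∧y≤y x z)

  𝟘∨x≡x : ∀ x → 𝟘 ∨ x ≡ x
  𝟘∨x≡x x = begin
    𝟘 ∨ x        ≡⟨ cong (_∨ x) (𝟘-least x) ⟨
    (𝟘 ∧ x) ∨ x  ≡⟨ cong (_∨ x) (∧-comm 𝟘 x) ⟩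
    (x ∧ 𝟘) ∨ x  ≡⟨ ∨-comm _ x ⟩
    x ∨ (x ∧ 𝟘)  ≡⟨ ∨-absorbs-∧ x 𝟘 ⟩
    x            ∎

  𝟙∧x≡x : ∀ x → 𝟙 ∧ x ≡ x
  𝟙∧x≡x x = trans (∧-comm 𝟙 x) (𝟙-greatest x)

  x≤𝟘⇒x≡𝟘 : ∀ {x} → x ≤ 𝟘 → x ≡ 𝟘
  x≤𝟘⇒x≡𝟘 {x} x≤𝟘 = trans (sym x≤𝟘) (trans (∧-comm x 𝟘) (𝟘-least x))

  x∨xᐞ≡𝟙 : ∀ x → x ∨ x ᐞ ≡ 𝟙
  x∨xᐞ≡𝟙 x = trans (cong₂ _∨_ (sym (𝟙∧x≡x x)) (sym (𝟙∧x≡x (x ᐞ)))) (Δ-split 𝟙 x)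

  x∧y≡𝟘⇒x≤yᐞ : ∀ {x y} → x ∧ y ≡ 𝟘 → x ≤ y ᐞ
  x∧y≡𝟘⇒x≤yᐞ {x} {y} x∧y≡𝟘 = begin
    x ∧ y ᐞ                ≡⟨ 𝟘∨x≡x _ ⟨
    𝟘 ∨ (x ∧ y ᐞ)          ≡⟨ cong (_∨ (x ∧ y ᐞ)) x∧y≡𝟘 ⟨
    (x ∧ y) ∨ (x ∧ y ᐞ)    ≡⟨ Δ-split x y ⟩
    x                      ∎

  𝟘ᐞ≡𝟙 : 𝟘 ᐞ ≡ 𝟙
  𝟘ᐞ≡𝟙 = trans (sym (𝟘∨x≡x (𝟘 ᐞ))) (x∨xᐞ≡𝟙 𝟘)

  𝟙ᐞ≡𝟘 : 𝟙 ᐞ ≡ 𝟘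
  𝟙ᐞ≡𝟘 = x≤𝟘⇒x≡𝟘 (subst (λ t → t ᐞ ≤ 𝟘) 𝟘ᐞ≡𝟙 (ΔΔ-deflationary 𝟘))

  𝟙∈S̄ : 𝟙 ∈ S̄
  𝟙∈S̄ = trans (cong _ᐞ 𝟙ᐞ≡𝟘) 𝟘ᐞ≡𝟙

  ᐞ∈S̄ : ∀ {x} → x ∈ S̄ → x ᐞ ∈ S̄
  ᐞ∈S̄ = cong _ᐞ

  x⊓̄xᐞ≡𝟘 : ∀ x → x ⊓̄ (x ᐞ) ≡ 𝟘
  x⊓̄xᐞ≡𝟘 x = trans (cong _ᐞ (x∨xᐞ≡𝟙 (x ᐞ))) 𝟙ᐞ≡𝟘

  xᐞ⊓̄yᐞ≡[x∨y]ᐞ : ∀ {x y} → x ∈ S̄ → y ∈ S̄ → (x ᐞ) ⊓̄ (y ᐞ) ≡ (x ∨ y) ᐞ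
  xᐞ⊓̄yᐞ≡[x∨y]ᐞ x∈S̄ y∈S̄ = cong _ᐞ (cong₂ _∨_ x∈S̄ y∈S̄)

  module _ {ℓ} {E : Pred Carrier ℓ} (isE : IsS̄Filter E) where
    open IsS̄Filter isE

    𝟙∈S̄Filter : 𝟙 ∈ E
    𝟙∈S̄Filter = up-closed (proj₂ nonempty) 𝟙∈S̄ (𝟙-greatest _)

    x∈∧xᐞ∈⇒S̄⊆ : ∀ {x} → x ∈ E → x ᐞ ∈ E → S̄ ⊆ E
    x∈∧xᐞ∈⇒S̄⊆ {x} x∈E xᐞ∈E {y} y∈S̄ =
      up-closed (subst E (x⊓̄xᐞ≡𝟘 x) (⊓̄-closed x∈E xᐞ∈E)) y∈S̄ (𝟘-least y)

  module _ {ℓ} {E : Pred Carrier ℓ} where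

    primary⇒prime : IsPrimaryS̄Filter E → IsPrimeS̄Filter E
    primary⇒prime (isE , primary) = isE , prime
      where
      open IsS̄Filter isE
      prime : ∀ x y → x ∈ S̄ → y ∈ S̄ → x ∨ y ∈ E → x ∈ E ⊎ y ∈ E
      prime x y x∈S̄ y∈S̄ x∨y∈E with primary x x∈S̄ | primary y y∈S̄
      ... | inj₁ x∈E  | _         = inj₁ x∈E
      ... | inj₂ _    | inj₁ y∈E  = inj₂ y∈E
      ... | inj₂ xᐞ∈E | inj₂ yᐞ∈E = inj₁ (x∈∧xᐞ∈⇒S̄⊆ isE x∨y∈E [x∨y]ᐞ∈E x∈S̄)
        where
        [x∨y]ᐞ∈E : (x ∨ y) ᐞ ∈ E
        [x∨y]ᐞ∈E = subst E (xᐞ⊓̄yᐞ≡[x∨y]ᐞ x∈S̄ y∈S̄) (⊓̄-closed xᐞ∈E yᐞ∈E)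

    prime⇒primary : IsPrimeS̄Filter E → IsPrimaryS̄Filter E
    prime⇒primary (isE , prime) = isE , λ x x∈S̄ →
      prime x (x ᐞ) x∈S̄ (ᐞ∈S̄ x∈S̄) (subst E (sym (x∨xᐞ≡𝟙 x)) (𝟙∈S̄Filter isE))

    primary⇒maximal : IsPrimaryS̄Filter E → IsMaximalS̄Filter E
    primary⇒maximal (isE , primary) =
      isE , λ (H , isH , (E⊆H , x , x∈H , x∉E) , (_ , y , y∈S̄ , y∉H)) →
        [ x∉E , (λ xᐞ∈E → y∉H (x∈∧xᐞ∈⇒S̄⊆ isH x∈H (E⊆H xᐞ∈E) y∈S̄)) ]′
          (primary x (IsS̄Filter.⊆S̄ isH x∈H))

  IsFilter-resp-≐ : ∀ {ℓ₁ ℓ₂} {F : Pred Carrier ℓ₁} {G : Pred Carrier ℓ₂} →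
                    F ≐ G → IsFilter F → IsFilter G
  IsFilter-resp-≐ (F⊆G , G⊆F) isF = record
    { nonempty  = proj₁ nonempty , F⊆G (proj₂ nonempty)
    ; up-closed = λ x∈G x≤y → F⊆G (up-closed (G⊆F x∈G) x≤y)
    ; ∧-closed  = λ x∈G y∈G → F⊆G (∧-closed (G⊆F x∈G) (G⊆F y∈G))
    }
    where open IsFilter isF

  _↑_ : ∀ {ℓ} → Pred Carrier ℓ → Carrier → Pred Carrier (c ⊔ ℓ)
  (F ↑ x) y = Σ Carrier λ f → f ∈ F × f ∧ x ≤ y

  module _ {ℓ} {F : Pred Carrier ℓ} (isF : IsFilter F) where
    open IsFilter isF

    ↑-isFilter : ∀ x → IsFilter (F ↑ x)
    ↑-isFilter x = record
      { nonempty  = x , proj₁ nonempty , proj₂ nonempty , x∧y≤y _ x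
      ; up-closed = λ (f , f∈F , f∧x≤y) y≤z → f , f∈F , ≤-trans f∧x≤y y≤z
      ; ∧-closed  = λ (f , f∈F , f∧x≤y) (g , g∈F , g∧x≤z) →
          f ∧ g , ∧-closed f∈F g∈F ,
          ∧-greatest (≤-trans (∧-monoˡ-≤ x (x∧y≤x f g)) f∧x≤y)
                     (≤-trans (∧-monoˡ-≤ x (x∧y≤y f g)) g∧x≤z)
      }

    ⊆↑ : ∀ x → F ⊆ F ↑ x
    ⊆↑ x {f} f∈F = f , f∈F , x∧y≤x f x

    ∈↑ : ∀ x → x ∈ F ↑ x
    ∈↑ x = proj₁ nonempty , proj₂ nonempty , x∧y≤y _ x

    𝟘∈↑⇒ᐞ∈ : ∀ {x} → 𝟘 ∈ F ↑ x → x ᐞ ∈ F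
    𝟘∈↑⇒ᐞ∈ (f , f∈F , f∧x≤𝟘) = up-closed f∈F (x∧y≡𝟘⇒x≤yᐞ (x≤𝟘⇒x≡𝟘 f∧x≤𝟘))

  module _ {ℓ} (em : ExcludedMiddle (c ⊔ ℓ)) {F : Pred Carrier ℓ} where
    open Resize em

    maximal-∉⇒ᐞ∈ : IsMaximalFilter F → ∀ {x} → x ∉ F → x ᐞ ∈ F
    maximal-∉⇒ᐞ∈ (isF , _ , unextendable) {x} x∉F = 𝟘∈↑⇒ᐞ∈ isF (em⇒dne em ¬𝟘∉F↑x)
      where
      G : Pred Carrier ℓ
      G y = Resized (y ∈ F ↑ x)

      ¬𝟘∉F↑x : ¬ (𝟘 ∉ F ↑ x)
      ¬𝟘∉F↑x 𝟘∉F↑x = unextendable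
        ( G
        , IsFilter-resp-≐ (resize , unresize) (↑-isFilter isF x)
        , (𝟘 , 𝟘∉F↑x ∘ unresize)
        , (resize ∘ ⊆↑ isF x) , x , resize (∈↑ isF x) , x∉F
        )

    maximal⇒primary : IsMaximalFilter F → IsPrimaryFilter F
    maximal⇒primary maximal = proj₁ maximal , ∈⊎ᐞ∈
      where
      ∈⊎ᐞ∈ : ∀ x → x ∈ F ⊎ x ᐞ ∈ F
      ∈⊎ᐞ∈ x with em {Lift c (x ∈ F)}
      ... | yes (lift x∈F) = inj₁ x∈F
      ... | no x∉F         = inj₂ (maximal-∉⇒ᐞ∈ maximal (x∉F ∘ lift))

data Three : Set where
  bot mid top : Three

infixr 7 _⊓₃_
infixr 6 _⊔₃_

_⊓₃_ : Three → Three → Three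
bot ⊓₃ _   = bot
mid ⊓₃ bot = bot
mid ⊓₃ _   = mid
top ⊓₃ y   = y

_⊔₃_ : Three → Three → Three
bot ⊔₃ y   = y
mid ⊔₃ top = top
mid ⊔₃ _   = mid
top ⊔₃ _   = top

_ᐞ₃ : Three → Three
top ᐞ₃ = bot
_   ᐞ₃ = top

_ᐯ₃ : Three → Three
bot ᐯ₃ = top
_   ᐯ₃ = bot

⊓₃-assoc : ∀ x y z → (x ⊓₃ y) ⊓₃ z ≡ x ⊓₃ (y ⊓₃ z)
⊓₃-assoc bot _   _   = refl
⊓₃-assoc top _   _   = refl
⊓₃-assoc mid bot _   = refl
⊓₃-assoc mid mid bot = refl
⊓₃-assoc mid mid mid = refl
⊓₃-assoc mid mid top = refl
⊓₃-assoc mid top bot = refl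
⊓₃-assoc mid top mid = refl
⊓₃-assoc mid top top = refl

⊔₃-assoc : ∀ x y z → (x ⊔₃ y) ⊔₃ z ≡ x ⊔₃ (y ⊔₃ z)
⊔₃-assoc bot _   _   = refl
⊔₃-assoc top _   _   = refl
⊔₃-assoc mid bot _   = refl
⊔₃-assoc mid mid bot = refl
⊔₃-assoc mid mid mid = refl
⊔₃-assoc mid mid top = refl
⊔₃-assoc mid top _   = refl

three : WDL 0ℓ
three = record
  { Carrier = Three ; _∧_ = _⊓₃_ ; _∨_ = _⊔₃_ ; _ᐞ = _ᐞ₃ ; _ᐯ = _ᐯ₃ ; 𝟘 = bot ; 𝟙 = top
  ; isLattice = record
    { isEquivalence = isEquivalence
    ; ∨-comm     = all₂ (λ x y → x ⊔₃ y ≡ y ⊔₃ x) refl refl refl refl refl refl refl refl refl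
    ; ∨-assoc    = ⊔₃-assoc
    ; ∨-cong     = cong₂ _⊔₃_
    ; ∧-comm     = all₂ (λ x y → x ⊓₃ y ≡ y ⊓₃ x) refl refl refl refl refl refl refl refl refl
    ; ∧-assoc    = ⊓₃-assoc
    ; ∧-cong     = cong₂ _⊓₃_
    ; absorptive =
        all₂ (λ x y → x ⊔₃ x ⊓₃ y ≡ x) refl refl refl refl refl refl refl refl refl ,
        all₂ (λ x y → x ⊓₃ (x ⊔₃ y) ≡ x) refl refl refl refl refl refl refl refl refl
    }
  ; 𝟘-least         = λ _ → refl
  ; 𝟙-greatest      = all (λ x → x ⊓₃ top ≡ x) refl refl refl
  ; ΔΔ-deflationary = all (λ x → (x ᐞ₃) ᐞ₃ ⊓₃ x ≡ (x ᐞ₃) ᐞ₃) refl refl refl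
  ; Δ-antitone      = λ { bot bot _ → refl ; bot mid _ → refl ; bot top _ → refl
                        ; mid mid _ → refl ; mid top _ → refl ; top top _ → refl
                        ; mid bot () ; top bot () ; top mid () }
  ; Δ-split         = all₂ (λ x y → x ⊓₃ y ⊔₃ x ⊓₃ y ᐞ₃ ≡ x) refl refl refl refl refl refl refl refl refl
  ; ∇∇-inflationary = all (λ x → x ⊓₃ (x ᐯ₃) ᐯ₃ ≡ x) refl refl refl
  ; ∇-antitone      = λ { bot bot _ → refl ; bot mid _ → refl ; bot top _ → refl
                        ; mid mid _ → refl ; mid top _ → refl ; top top _ → refl
                        ; mid bot () ; top bot () ; top mid () }
  ; ∇-split         = all₂ (λ x y → (x ⊔₃ y) ⊓₃ (x ⊔₃ y ᐯ₃) ≡ x) refl refl refl refl refl refl refl refl refl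
  }
  where
  all : (P : Three → Set) → P bot → P mid → P top → ∀ x → P x
  all P p _ _ bot = p
  all P _ p _ mid = p
  all P _ _ p top = p

  all₂ : (P : Three → Three → Set) →
         P bot bot → P bot mid → P bot top →
         P mid bot → P mid mid → P mid top →
         P top bot → P top mid → P top top → ∀ x y → P x y
  all₂ P p₁ p₂ p₃ p₄ p₅ p₆ p₇ p₈ p₉ x y =
    all (λ x → ∀ y → P x y) (all (P bot) p₁ p₂ p₃) (all (P mid) p₄ p₅ p₆) (all (P top) p₇ p₈ p₉) x y

IsTop : Pred Three 0ℓ
IsTop x = x ≡ top

IsAboveBot : Pred Three 0ℓ
IsAboveBot bot = ⊥
IsAboveBot _   = ⊤

primary-not-maximal : Σ (WDL 0ℓ) λ L → let open WDLTheory L in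
    Σ (Pred Carrier 0ℓ) λ F →
    IsPrimaryFilter F × IsProper F × ¬ IsMaximalFilter F
primary-not-maximal = three , IsTop , (isFilterTop , primary) , (bot , λ ()) , notMaximal
  where
  open WDLTheory three

  isFilterTop : IsFilter IsTop
  isFilterTop = record
    { nonempty  = top , refl
    ; up-closed = λ { refl top⊓y≡top → top⊓y≡top }
    ; ∧-closed  = λ { refl refl → refl }
    }

  primary : ∀ x → IsTop x ⊎ IsTop (x ᐞ)
  primary bot = inj₂ refl
  primary mid = inj₂ refl
  primary top = inj₁ refl

  isFilterAboveBot : IsFilter IsAboveBot
  isFilterAboveBot = record
    { nonempty  = top , tt
    ; up-closed = λ { {mid} {mid} _ _ → tt ; {mid} {top} _ _ → tt ; {top} {top} _ _ → tt
                    ; {mid} {bot} _ () ; {top} {bot} _ () ; {top} {mid} _ () }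
    ; ∧-closed  = λ { {mid} {mid} _ _ → tt ; {mid} {top} _ _ → tt
                    ; {top} {mid} _ _ → tt ; {top} {top} _ _ → tt }
    }

  notMaximal : ¬ IsMaximalFilter IsTop
  notMaximal (_ , _ , unextendable) =
    unextendable (IsAboveBot , isFilterAboveBot , (bot , λ ()) , (λ { refl → tt }) , mid , tt , λ ())

theorem5p3 : ∀ {c ℓ : Level} →
    ((L : WDL c) → let open WDLTheory L in
      -- (1)
      (∀ (E : Pred Carrier ℓ) → IsS̄Filter E →
        IsPrimaryS̄Filter E ⇔ IsPrimeS̄Filter E)
      -- (2)
      × (∀ (E : Pred Carrier ℓ) → IsS̄Filter E →
        IsPrimaryS̄Filter E → IsMaximalS̄Filter E)
      -- (3), first part (classical reasoning made explicit)
      × (ExcludedMiddle (c ⊔ ℓ) → ∀ (F : Pred Carrier ℓ) → IsFilter F →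
        IsMaximalFilter F → IsPrimaryFilter F))
    -- (3), the converse fails
    × (Σ (WDL 0ℓ) λ L → let open WDLTheory L in
        Σ (Pred Carrier 0ℓ) λ F →
          IsPrimaryFilter F × IsProper F × ¬ IsMaximalFilter F)
theorem5p3 =
  (λ L → let open WDLProperties L in
      (λ _ _ → mk⇔ primary⇒prime prime⇒primary)
    , (λ _ _ → primary⇒maximal)
    , (λ em _ _ → maximal⇒primary em))
  , primary-not-maximal
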